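{- The category $\mathbf{Grph}_{mono}$, equipped with the spine $n\mapsto K_n$ and with clique sums as proxy pushouts (the span $G\xleftarrow{g}K_n\xrightarrow{h}H$ is sent to $G\#_{K_n}H$ with its two canonical inclusions), is a spined category.
   Context: Graphs are finite, without loops or parallel edges. $\mathbf{Grph}_{mono}$ is the category of such graphs with injective graph homomorphisms. $K_n$ is the complete graph on $[n]=\{1,\dots,n\}$. For injective homomorphisms $g:K_n\to G$, $h:K_n\to H$, the clique sum $G\#_{K_n}H$ is obtained from the disjoint union of $G$ and $H$ by identifying $g(v)$ with $h(v)$ for every vertex $v$ of $K_n$ and removing resulting parallel edges. A spined category is a triple $(\mathcal{C},\Omega,\mathfrak{P})$: a category, a sequence of objects $(\Omega_n)_{n\in\mathbb{N}}$, and an operation $\mathfrak{P}$ assigning to each span $G\xleftarrow{g}\Omega_n\xrightarrow{h}H$ an object $\mathfrak{P}(g,h)$ and morphisms $\mathfrak{P}(g,h)_g:G\to\mathfrak{P}(g,h)$, $\mathfrak{P}(g,h)_h:H\to\mathfrak{P}(g,h)$ with $\mathfrak{P}(g,h)_gg=\mathfrak{P}(g,h)_hh$, such that (SC1) every object has a morphism to some $\Omega_n$; (SC2) for every such span and all $g':G\to G'$, $h':H\to H'$ there is a unique morphism $(g',h'):\mathfrak{P}(g,h)\to\mathfrak{P}(g'g,h'h)$ with $(g',h')\mathfrak{P}(g,h)_g=\mathfrak{P}(g'g,h'h)_{g'g}g'$ and $(g',h')\mathfrak{P}(g,h)_h=\mathfrak{P}(g'g,h'h)_{h'h}h'$. 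-}

module Defs where

open import Level using (Level) renaming (suc to lsuc)
open import Data.Nat using (ℕ)
open import Data.Fin using (Fin) renaming (_≟_ to _≟F_)
open import Data.Fin.Properties using (any?)
open import Data.Bool.Properties using (T-irrelevant)
open import Data.List using (List; []; _∷_; _++_; map; allFin)
open import Data.List.Membership.Propositional using (_∈_)
open import Data.List.Membership.Propositional.Properties using (∈-allFin; ∈-++⁺ˡ; ∈-++⁺ʳ; ∈-map⁺)
open import Data.List.Relation.Unary.Any using (here; there)
open import Data.Product using (Σ; ∃; _×_; _,_; proj₁; proj₂)
open import Data.Sum using (_⊎_; inj₁; inj₂)
open import Data.Sum.Properties using (inj₁-injective; inj₂-injective)
open import Function using (_∘′_)
open import Relation.Nullary using (¬_; Dec; yes; no; contradiction)
open import Relation.Nullary.Decidable using (False; fromWitnessFalse; toWitnessFalse)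
open import Relation.Binary using (IsEquivalence)
open import Relation.Binary.Definitions using (DecidableEquality)
open import Relation.Binary.PropositionalEquality
  using (_≡_; refl; sym; trans; cong; subst; isEquivalence)

record Category : Set₂ where
  infix  4 _≈_
  infixr 9 _∘_
  field
    Obj   : Set₁
    Hom   : Obj → Obj → Set
    _≈_   : ∀ {A B} → Hom A B → Hom A B → Set
    ≈-equiv : ∀ {A B} → IsEquivalence (_≈_ {A} {B})
    id    : ∀ {A} → Hom A A
    _∘_   : ∀ {A B C} → Hom B C → Hom A B → Hom A C
    ∘-cong : ∀ {A B C} {f f′ : Hom B C} {g g′ : Hom A B} →
             f ≈ f′ → g ≈ g′ → f ∘ g ≈ f′ ∘ g′
    idˡ   : ∀ {A B} (f : Hom A B) → id ∘ f ≈ f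
    idʳ   : ∀ {A B} (f : Hom A B) → f ∘ id ≈ f
    assoc : ∀ {A B C D} (f : Hom C D) (g : Hom B C) (h : Hom A B) →
            (f ∘ g) ∘ h ≈ f ∘ (g ∘ h)

record ProxyPushout (𝒞 : Category) (Ω : ℕ → Category.Obj 𝒞) : Set₁ where
  open Category 𝒞
  field
    P    : ∀ {n G H} → Hom (Ω n) G → Hom (Ω n) H → Obj
    inG  : ∀ {n G H} (g : Hom (Ω n) G) (h : Hom (Ω n) H) → Hom G (P g h)
    inH  : ∀ {n G H} (g : Hom (Ω n) G) (h : Hom (Ω n) H) → Hom H (P g h)
    comm : ∀ {n G H} (g : Hom (Ω n) G) (h : Hom (Ω n) H) →
           inG g h ∘ g ≈ inH g h ∘ h

record IsSpinedCategory (𝒞 : Category) (Ω : ℕ → Category.Obj 𝒞)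
                        (𝔓 : ProxyPushout 𝒞 Ω) : Set₁ where
  open Category 𝒞
  open ProxyPushout 𝔓
  field
    SC1 : ∀ (G : Obj) → Σ ℕ λ n → Hom G (Ω n)
    SC2 : ∀ {n G H G′ H′} (g : Hom (Ω n) G) (h : Hom (Ω n) H)
            (g′ : Hom G G′) (h′ : Hom H H′) →
          Σ (Hom (P g h) (P (g′ ∘ g) (h′ ∘ h))) λ u →
            (u ∘ inG g h ≈ inG (g′ ∘ g) (h′ ∘ h) ∘ g′) ×
            (u ∘ inH g h ≈ inH (g′ ∘ g) (h′ ∘ h) ∘ h′) ×
            (∀ (u′ : Hom (P g h) (P (g′ ∘ g) (h′ ∘ h))) →
               u′ ∘ inG g h ≈ inG (g′ ∘ g) (h′ ∘ h) ∘ g′ →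
               u′ ∘ inH g h ≈ inH (g′ ∘ g) (h′ ∘ h) ∘ h′ →
               u′ ≈ u)

-- The vertex set is a type with decidable equality and an exhaustive
-- list of its elements (i.e. it is finite); the edge relation is
-- symmetric and irreflexive (no loops; being a relation, no parallel edges).

record Graph : Set₁ where
  field
    V        : Set
    _≟_      : DecidableEquality V
    enum     : List V
    complete : ∀ v → v ∈ enum
    E        : V → V → Set
    E-sym    : ∀ {x y} → E x y → E y x
    E-irr    : ∀ {x} → ¬ E x x

open Graph

record Mono (G H : Graph) : Set where
  field
    fun  : V G → V H
    pres : ∀ {x y} → E G x y → E H (fun x) (fun y)
    inj  : ∀ {x y} → fun x ≡ fun y → x ≡ y

open Mono

_≈M_ : ∀ {G H} → Mono G H → Mono G H → Set
f ≈M f′ = ∀ x → fun f x ≡ fun f′ x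

idM : ∀ {G} → Mono G G
idM = record { fun = λ x → x ; pres = λ e → e ; inj = λ p → p }

_∘M_ : ∀ {A B C} → Mono B C → Mono A B → Mono A C
f ∘M g = record
  { fun  = λ x → fun f (fun g x)
  ; pres = λ e → pres f (pres g e)
  ; inj  = λ p → inj g (inj f p) }

GrphMono : Category
GrphMono = record
  { Obj = Graph
  ; Hom = Mono
  ; _≈_ = _≈M_
  ; ≈-equiv = record
      { refl  = λ x → refl
      ; sym   = λ p x → sym (p x)
      ; trans = λ p q x → trans (p x) (q x) }
  ; id = idM
  ; _∘_ = _∘M_
  ; ∘-cong = λ {_} {_} {_} {f} {f′} {g} {g′} p q x →
      trans (cong (fun f) (q x)) (p (fun g′ x))
  ; idˡ = λ f x → refl
  ; idʳ = λ f x → refl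
  ; assoc = λ f g h x → refl }

K : ℕ → Graph
K n = record
  { V = Fin n
  ; _≟_ = _≟F_
  ; enum = allFin n
  ; complete = ∈-allFin
  ; E = λ i j → ¬ i ≡ j
  ; E-sym = λ p q → p (sym q)
  ; E-irr = λ p → p refl }

-- Vertex set: V(G) ⊎ (vertices of H not in the image of h); a vertex
-- h(v) of H is identified with g(v) of G.  Edges are the images of the
-- edges of G and of H (parallel edges merged).

module CliqueSum {n : ℕ} {G H : Graph} (g : Mono (K n) G) (h : Mono (K n) H) where

  preim : (y : V H) → Dec (Σ (Fin n) λ v → fun h v ≡ y)
  preim y = any? (λ v → _≟_ H (fun h v) y)

  Out : Set
  Out = Σ (V H) λ y → False (preim y)

  Vtx : Set
  Vtx = V G ⊎ Out

  _≟O_ : DecidableEquality Out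
  (y , p) ≟O (z , q) with _≟_ H y z
  ... | yes refl = yes (cong (y ,_) (T-irrelevant p q))
  ... | no y≢z   = no (λ eq → y≢z (cong proj₁ eq))

  _≟Vtx_ : DecidableEquality Vtx
  inj₁ a ≟Vtx inj₁ b with _≟_ G a b
  ... | yes refl = yes refl
  ... | no a≢b   = no (λ eq → a≢b (inj₁-injective eq))
  inj₁ a ≟Vtx inj₂ z = no (λ ())
  inj₂ y ≟Vtx inj₁ b = no (λ ())
  inj₂ y ≟Vtx inj₂ z with y ≟O z
  ... | yes refl = yes refl
  ... | no y≢z   = no (λ eq → y≢z (inj₂-injective eq))

  step : (y : V H) → Dec (Σ (Fin n) λ v → fun h v ≡ y) → List Out → List Out
  step y (yes _) rest = rest
  step y (no ¬p) rest = (y , fromWitnessFalse ¬p) ∷ rest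

  outs : List (V H) → List Out
  outs [] = []
  outs (y ∷ ys) = step y (preim y) (outs ys)

  step-here : ∀ y (d : Dec (Σ (Fin n) λ v → fun h v ≡ y)) (p : False d)
                (q : False (preim y)) rest → (y , q) ∈ step y d rest
  step-here y (no ¬p) p q rest = here (cong (y ,_) (T-irrelevant _ _))

  step-there : ∀ y d rest (x : Out) → x ∈ rest → x ∈ step y d rest
  step-there y (yes _) rest x m = m
  step-there y (no _) rest x m = there m

  outs-complete : ∀ ys y (p : False (preim y)) → y ∈ ys → (y , p) ∈ outs ys
  outs-complete (y ∷ ys) .y p (here refl) = step-here y (preim y) p p (outs ys)
  outs-complete (y′ ∷ ys) y p (there m) =
    step-there y′ (preim y′) (outs ys) (y , p) (outs-complete ys y p m)

  enumVtx : List Vtx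
  enumVtx = map inj₁ (enum G) ++ map inj₂ (outs (enum H))

  completeVtx : ∀ x → x ∈ enumVtx
  completeVtx (inj₁ a) = ∈-++⁺ˡ (∈-map⁺ inj₁ (complete G a))
  completeVtx (inj₂ (y , p)) =
    ∈-++⁺ʳ (map inj₁ (enum G))
           (∈-map⁺ inj₂ (outs-complete (enum H) y p (complete H y)))

  SE : Vtx → Vtx → Set
  SE (inj₁ a) (inj₁ b) = E G a b
  SE (inj₁ a) (inj₂ (z , _)) = Σ (Fin n) λ v → fun g v ≡ a × E H (fun h v) z
  SE (inj₂ (y , _)) (inj₁ b) = Σ (Fin n) λ v → fun g v ≡ b × E H y (fun h v)
  SE (inj₂ (y , _)) (inj₂ (z , _)) = E H y z

  SE-sym : ∀ {x y} → SE x y → SE y x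
  SE-sym {inj₁ a} {inj₁ b} e = E-sym G e
  SE-sym {inj₁ a} {inj₂ _} (v , eq , e) = v , eq , E-sym H e
  SE-sym {inj₂ _} {inj₁ b} (v , eq , e) = v , eq , E-sym H e
  SE-sym {inj₂ _} {inj₂ _} e = E-sym H e

  SE-irr : ∀ {x} → ¬ SE x x
  SE-irr {inj₁ a} = E-irr G
  SE-irr {inj₂ _} = E-irr H

  sum : Graph
  sum = record
    { V = Vtx
    ; _≟_ = _≟Vtx_
    ; enum = enumVtx
    ; complete = completeVtx
    ; E = SE
    ; E-sym = λ {x} {y} → SE-sym {x} {y}
    ; E-irr = λ {x} → SE-irr {x} }

  ιG : Mono G sum
  ιG = record { fun = inj₁ ; pres = λ e → e ; inj = inj₁-injective }

  ι′ : (y : V H) → Dec (Σ (Fin n) λ v → fun h v ≡ y) → Vtx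
  ι′ y (yes (v , _)) = inj₁ (fun g v)
  ι′ y (no ¬p)       = inj₂ (y , fromWitnessFalse ¬p)

  ι′-pres : ∀ {y z} dy dz → E H y z → SE (ι′ y dy) (ι′ z dz)
  ι′-pres {y} {z} (yes (v , refl)) (yes (w , refl)) e =
    pres g (λ v≡w → E-irr H (subst (λ u → E H (fun h v) (fun h u)) (sym v≡w) e))
  ι′-pres (yes (v , refl)) (no _) e = v , refl , e
  ι′-pres (no _) (yes (w , refl)) e = w , refl , e
  ι′-pres (no _) (no _) e = e

  ι′-inj : ∀ {y z} dy dz → ι′ y dy ≡ ι′ z dz → y ≡ z
  ι′-inj (yes (v , refl)) (yes (w , refl)) eq = cong (fun h) (inj g (inj₁-injective eq))
  ι′-inj (yes _) (no _) ()
  ι′-inj (no _) (yes _) ()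
  ι′-inj (no _) (no _) eq = cong proj₁ (inj₂-injective eq)

  ιH : Mono H sum
  ιH = record
    { fun  = λ y → ι′ y (preim y)
    ; pres = λ {y} {z} e → ι′-pres (preim y) (preim z) e
    ; inj  = λ {y} {z} eq → ι′-inj (preim y) (preim z) eq }

  comm′ : ∀ v d → inj₁ (fun g v) ≡ ι′ (fun h v) d
  comm′ v (yes (w , hw≡hv)) = cong (λ u → inj₁ (fun g u)) (sym (inj h hw≡hv))
  comm′ v (no ¬p) = contradiction (v , refl) ¬p

  comm : (ιG ∘M g) ≈M (ιH ∘M h)
  comm v = comm′ v (preim (fun h v))

cliqueSum : ProxyPushout GrphMono K
cliqueSum = record
  { P    = λ g h → CliqueSum.sum g h
  ; inG  = λ g h → CliqueSum.ιG g h
  ; inH  = λ g h → CliqueSum.ιH g h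
  ; comm = λ g h → CliqueSum.comm g h }

-- A finite loopless graph embeds into the complete graph on its vertices,
-- giving (SC1).  For (SC2), every vertex of G #_{K_n} H lies in G or
-- outside the image of h in H, so the two inclusions are jointly
-- epimorphic and the induced map is unique; it exists because the glued
-- vertices h(v) of H go, under h′, to the glued vertices h′(h(v)) of the
-- second clique sum, while vertices outside the image of h stay outside
-- the image of h′ ∘ h since h′ is injective.
module Submission where

open import Defs
open import Data.Nat using (ℕ)
open import Data.Fin using (Fin)
open import Data.List using (length)
open import Data.List.Relation.Unary.Any using (index)
open import Data.List.Membership.Setoid.Properties using (index-injective)
open import Data.Product using (Σ; _,_)
open import Data.Sum using (inj₁; inj₂)
open import Data.Sum.Properties using (inj₁-injective)
open import Data.Bool.Properties using (T-irrelevant)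
open import Function.Definitions using (Injective)
open import Relation.Nullary using (¬_; yes; no; contradiction)
open import Relation.Nullary.Decidable using (False; toWitnessFalse)
open import Relation.Binary.PropositionalEquality
  using (_≡_; refl; sym; trans; cong; subst; setoid)

open Graph
open Mono

injective⇒Mono-K : ∀ {m} (G : Graph) (f : V G → Fin m) →
                   Injective _≡_ _≡_ f → Mono G (K m)
injective⇒Mono-K G f f-inj = record
  { fun  = f
  ; pres = λ e fx≡fy → E-irr G (subst (E G _) (sym (f-inj fx≡fy)) e)
  ; inj  = f-inj }

Mono-K-size : ∀ (G : Graph) → Mono G (K (length (enum G)))
Mono-K-size G = injective⇒Mono-K G (λ v → index (complete G v))
  (λ {x} {y} → index-injective (setoid (V G)) (complete G x) (complete G y))

module CliqueSumProperties {n : ℕ} {G H : Graph}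
                           (g : Mono (K n) G) (h : Mono (K n) H) where
  open CliqueSum g h

  ι′-outside : ∀ y d (p : False (preim y)) → False d → ι′ y d ≡ inj₂ (y , p)
  ι′-outside y (no _) p _ = cong (λ q → inj₂ (y , q)) (T-irrelevant _ p)

  ιH-outside : ∀ y (p : False (preim y)) → fun ιH y ≡ inj₂ (y , p)
  ιH-outside y p = ι′-outside y (preim y) p p

  ιH≡inj₁⇒image : ∀ {y a} → fun ιH y ≡ inj₁ a → Σ (Fin n) λ v → fun h v ≡ y
  ιH≡inj₁⇒image {y} with preim y
  ... | yes image = λ _ → image
  ... | no _      = λ ()

  inclusions-jointly-epi : ∀ {X} (u u′ : Mono sum X) →
                           (u ∘M ιG) ≈M (u′ ∘M ιG) → (u ∘M ιH) ≈M (u′ ∘M ιH) →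
                           u ≈M u′
  inclusions-jointly-epi u u′ onG onH (inj₁ a)       = onG a
  inclusions-jointly-epi u u′ onG onH (inj₂ (y , p)) =
    subst (λ x → fun u x ≡ fun u′ x) (ιH-outside y p) (onH y)

module InducedMap {n : ℕ} {G H G′ H′ : Graph}
                  (g : Mono (K n) G) (h : Mono (K n) H)
                  (g′ : Mono G G′) (h′ : Mono H H′) where
  module S = CliqueSum g h
  module T = CliqueSum (g′ ∘M g) (h′ ∘M h)
  module SP = CliqueSumProperties g h
  module TP = CliqueSumProperties (g′ ∘M g) (h′ ∘M h)

  induced : S.Vtx → T.Vtx
  induced (inj₁ a)       = inj₁ (fun g′ a)
  induced (inj₂ (y , _)) = fun T.ιH (fun h′ y)

  glued : ∀ v → induced (inj₁ (fun g v)) ≡ fun T.ιH (fun h′ (fun h v))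
  glued = T.comm

  induced-pres : ∀ {x y} → S.SE x y → T.SE (induced x) (induced y)
  induced-pres {inj₁ _} {inj₁ _} e = pres g′ e
  induced-pres {inj₁ _} {inj₂ z} (v , refl , e) =
    subst (λ w → T.SE w (induced (inj₂ z))) (sym (glued v)) (pres T.ιH (pres h′ e))
  induced-pres {inj₂ y} {inj₁ _} (v , refl , e) =
    subst (T.SE (induced (inj₂ y))) (sym (glued v)) (pres T.ιH (pres h′ e))
  induced-pres {inj₂ _} {inj₂ _} e = pres T.ιH (pres h′ e)

  outside-stays-outside : ∀ a y → False (S.preim y) →
                          ¬ inj₁ (fun g′ a) ≡ fun T.ιH (fun h′ y)
  outside-stays-outside a y p eq =
    let v , h′hv≡h′y = TP.ιH≡inj₁⇒image (sym eq)
    in toWitnessFalse p (v , inj h′ h′hv≡h′y)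

  induced-inj : ∀ {x y} → induced x ≡ induced y → x ≡ y
  induced-inj {inj₁ _} {inj₁ _} eq = cong inj₁ (inj g′ (inj₁-injective eq))
  induced-inj {inj₁ a} {inj₂ (y , p)} eq = contradiction eq (outside-stays-outside a y p)
  induced-inj {inj₂ (y , p)} {inj₁ b} eq = contradiction (sym eq) (outside-stays-outside b y p)
  induced-inj {inj₂ (y , p)} {inj₂ (z , q)} eq with inj h′ (inj T.ιH eq)
  ... | refl = cong (λ r → inj₂ (y , r)) (T-irrelevant p q)

  inducedMono : Mono S.sum T.sum
  inducedMono = record
    { fun  = induced
    ; pres = λ {x} {y} → induced-pres {x} {y}
    ; inj  = λ {x} {y} → induced-inj {x} {y} }

  induced-ιG : (inducedMono ∘M S.ιG) ≈M (T.ιG ∘M g′)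
  induced-ιG _ = refl

  induced-ιH : (inducedMono ∘M S.ιH) ≈M (T.ιH ∘M h′)
  induced-ιH y = commutes (S.preim y)
    where
    commutes : ∀ d → induced (S.ι′ y d) ≡ fun T.ιH (fun h′ y)
    commutes (yes (v , refl)) = glued v
    commutes (no _)           = refl

  induced-unique : ∀ (u′ : Mono S.sum T.sum) →
                 (u′ ∘M S.ιG) ≈M (T.ιG ∘M g′) → (u′ ∘M S.ιH) ≈M (T.ιH ∘M h′) →
                 u′ ≈M inducedMono
  induced-unique u′ onG onH = SP.inclusions-jointly-epi u′ inducedMono
    (λ a → trans (onG a) (sym (induced-ιG a)))
    (λ y → trans (onH y) (sym (induced-ιH y)))

proposition3p4 : IsSpinedCategory GrphMono K cliqueSum
proposition3p4 = record
  { SC1 = λ G → length (enum G) , Mono-K-size G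
  ; SC2 = λ g h g′ h′ → let open InducedMap g h g′ h′
                         in inducedMono , induced-ιG , induced-ιH , induced-unique }
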